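{- Let $r\geq 2$ and let $\mathcal H$ be an $r$-uniform hypergraph on $n$ vertices with an ordering $e_1,\dots,e_m$ of its edges such that (i) $\mathcal H$ is induced $K_r^-$-free, and (ii) there exist subsets $f_i\subseteq e_i$ with $|f_i|=2$ for $1\leq i\leq m$ such that $f_i\subseteq e_j$ if and only if either $i=m=j$, or $i<m$ and $j\in\{i,i+1\}$. Let $G$ be the $2$-skeleton of $\mathcal H$. Then the $K_r$-process starting with $G_0:=G-\{f_i: i=1,\dots,m\}$ has running time at least $m$ (i.e. $G_m\neq G_{m-1}$). In particular, $M_r(n)\geq m=e(\mathcal H)$.
   Context: The $2$-skeleton of a hypergraph $\mathcal H$ is the graph $G$ on $V(\mathcal H)$ in which $ab$ is an edge iff $\{a,b\}\subseteq e$ for some $e\in E(\mathcal H)$. $K_r^-$ is the complete graph on $r$ vertices with one edge deleted. An $r$-uniform hypergraph $\mathcal H$ is induced $H$-free if every copy of $H$ in the $2$-skeleton of $\mathcal H$ has its vertex set contained in an edge of $\mathcal H$. The $K_r$-process on $n$ vertices from starting graph $G_0\subseteq K_n$: $G_t=G_{t-1}\cup\{e\in E(K_n): e \text{ completes a new copy of } K_r \text{ in } G_{t-1}\cup\{e\}\}$. $M_r(n)$ is the maximum over all starting graphs $G_0\subseteq K_n$ of the largest $t$ with $G_t\neq G_{t-1}$. -}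

module Defs where

open import Data.Nat using (ℕ; zero; suc; _<_; _∸_)
open import Data.Fin using (Fin; toℕ)
open import Data.Fin.Subset using (Subset; _∈_; _⊆_; ∣_∣)
open import Data.Product using (Σ; ∃; _×_)
open import Data.Sum using (_⊎_)
open import Data.Unit using (⊤)
open import Relation.Nullary using (¬_)
open import Relation.Binary.PropositionalEquality using (_≡_; _≢_)

Graph : ℕ → Set₁
Graph n = Fin n → Fin n → Set

-- A hypergraph on Fin n with an ordering e_0,…,e_{m-1} of its m edges.
Hyp : ℕ → ℕ → Set
Hyp n m = Fin m → Subset n

Uniform : ∀ {n m} → ℕ → Hyp n m → Set
Uniform r e = ∀ j → ∣ e j ∣ ≡ r

Skeleton : ∀ {n m} → Hyp n m → Graph n
Skeleton e a b = a ≢ b × ∃ λ j → a ∈ e j × b ∈ e j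

ContainsKrMinus : ∀ {n} → ℕ → Graph n → Subset n → Set
ContainsKrMinus r G S =
  ∣ S ∣ ≡ r × Σ _ λ x → Σ _ λ y → x ∈ S × y ∈ S × x ≢ y ×
    (∀ a b → a ∈ S → b ∈ S → a ≢ b → ¬ (a ≡ x × b ≡ y) → ¬ (a ≡ y × b ≡ x) → G a b)

-- induced K_r^- -free: every copy of K_r^- in the 2-skeleton lies inside an edge.
InducedKrMinusFree : ∀ {n m} → ℕ → Hyp n m → Set
InducedKrMinusFree r e = ∀ S → ContainsKrMinus r (Skeleton e) S → ∃ λ j → S ⊆ e j

CompletesKr : ∀ {n} → ℕ → Graph n → Fin n → Fin n → Set
CompletesKr r G u v =
  u ≢ v × ¬ G u v × Σ _ λ S → ∣ S ∣ ≡ r × u ∈ S × v ∈ S ×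
    (∀ a b → a ∈ S → b ∈ S → a ≢ b → ¬ (a ≡ u × b ≡ v) → ¬ (a ≡ v × b ≡ u) → G a b)

Process : ∀ {n} → ℕ → Graph n → ℕ → Graph n
Process r G0 zero    = G0
Process r G0 (suc t) u v = Process r G0 t u v ⊎ CompletesKr r (Process r G0 t) u v

RunningTimeAtLeast : ∀ {n} → ℕ → Graph n → ℕ → Set
RunningTimeAtLeast r G0 zero    = ⊤
RunningTimeAtLeast r G0 (suc t) =
  Σ _ λ u → Σ _ λ v → Process r G0 (suc t) u v × ¬ Process r G0 t u v

MAtLeast : ℕ → ℕ → ℕ → Set₁
MAtLeast r n m = Σ (Graph n) λ G0 → RunningTimeAtLeast r G0 m

RemovePairs : ∀ {n m} → Graph n → (Fin m → Subset n) → Graph n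
RemovePairs G f a b = G a b × ¬ (∃ λ i → a ∈ f i × b ∈ f i)

-- Condition (ii) (0-indexed): f_i ⊆ e_j iff (i = j = last) or (i < last and j ∈ {i, i+1}).
PairCondition : ∀ {m} → Fin m → Fin m → Set
PairCondition {m} i j =
  (toℕ i ≡ m ∸ 1 × toℕ j ≡ m ∸ 1) ⊎
  (toℕ i < m ∸ 1 × (toℕ j ≡ toℕ i ⊎ toℕ j ≡ suc (toℕ i)))

-- By induction on t, G_t is
-- exactly the skeleton with the pairs f_i, i ≥ t, removed. A pair f_t is added at step t+1
-- because e_t is then complete apart from f_t: the only other pair of e_t that was removed
-- is f_{t-1}, added one step earlier. Conversely, a pair completing a K_r in G_t spans a K_r⁻
-- of the skeleton, hence lies in an edge e_j (which by uniformity is the whole clique); if it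
-- were some f_i with i > t, then e_j would contain a second pair f_k with k ≥ t, still missing
-- from G_t, contradicting that the clique is complete apart from f_i.
module Submission where

open import Defs
open import Data.Nat using (ℕ; zero; suc; _+_; _≤_; _<_; z≤n; s≤s; s≤s⁻¹; _<?_)
open import Data.Nat.Properties
  using (1+n≢n; ≤-refl; ≤-reflexive; ≤-trans; <-irrefl; <-asym; <⇒≤; <⇒≢; <⇒≱; <-≤-trans;
         ≮⇒≥; ≤∧≢⇒<; m≤n⇒m<n∨m≡n; m<n⇒m<1+n; module ≤-Reasoning)
open import Data.Fin using (Fin; zero; suc; toℕ; fromℕ<; inject₁; _≟_)
open import Data.Fin.Properties using (suc-injective; toℕ-injective; toℕ≤pred[n]; toℕ<n; toℕ-fromℕ<; toℕ-inject₁)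
open import Data.Fin.Subset using (Subset; _∈_; _⊆_; _-_; ∣_∣; Nonempty; inside; outside)
open import Data.Fin.Subset.Properties
  using (_∈?_; nonempty?; Empty-unique; ∣⊥∣≡0; p⊂q⇒∣p∣<∣q∣; x∈p⇒∣p-x∣<∣p∣; x∈p∧x≢y⇒x∈p-y)
open import Data.Vec.Base using (_∷_; here; there)
open import Data.Product using (_×_; _,_; proj₁; proj₂; ∃; ∃₂)
open import Data.Sum using (_⊎_; inj₁; inj₂)
open import Data.Unit using (tt)
open import Function using (_∘_)
open import Function.Bundles using (_⇔_; mk⇔; Equivalence)
open import Function.Definitions using (Injective)
open import Relation.Nullary using (¬_; yes; no; contradiction)
open import Relation.Nullary.Decidable using (_×-dec_)
open import Relation.Binary.PropositionalEquality using (_≡_; _≢_; refl; sym; trans; cong; subst)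

open Equivalence using (to; from)

module _ {n : ℕ} where

  ∣p∣>0⇒Nonempty : {p : Subset n} → 0 < ∣ p ∣ → Nonempty p
  ∣p∣>0⇒Nonempty {p} 0<∣p∣ with nonempty? p
  ... | yes ne = ne
  ... | no ¬ne = contradiction (trans (cong ∣_∣ (Empty-unique ¬ne)) (∣⊥∣≡0 n)) (<⇒≢ 0<∣p∣ ∘ sym)

  ⊆∧∣p∣≡∣q∣⇒⊇ : {p q : Subset n} → p ⊆ q → ∣ p ∣ ≡ ∣ q ∣ → q ⊆ p
  ⊆∧∣p∣≡∣q∣⇒⊇ {p} p⊆q ∣p∣≡∣q∣ {x} x∈q with x ∈? p
  ... | yes x∈p = x∈p
  ... | no x∉p = contradiction (p⊂q⇒∣p∣<∣q∣ (p⊆q , x , x∈q , x∉p)) (<-irrefl ∣p∣≡∣q∣)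

  distinct₃⇒3≤∣p∣ : {p : Subset n} {x y z : Fin n} → x ∈ p → y ∈ p → z ∈ p →
    x ≢ y → x ≢ z → y ≢ z → 3 ≤ ∣ p ∣
  distinct₃⇒3≤∣p∣ {p} {x} {y} {z} x∈p y∈p z∈p x≢y x≢z y≢z = begin
    3                     ≤⟨ s≤s (s≤s (s≤s z≤n)) ⟩
    3 + ∣ p - x - y - z ∣ ≤⟨ s≤s (s≤s (x∈p⇒∣p-x∣<∣p∣ z∈p-x-y)) ⟩
    2 + ∣ p - x - y ∣     ≤⟨ s≤s (x∈p⇒∣p-x∣<∣p∣ y∈p-x) ⟩
    1 + ∣ p - x ∣         ≤⟨ x∈p⇒∣p-x∣<∣p∣ x∈p ⟩
    ∣ p ∣                 ∎
    where
    open ≤-Reasoning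
    y∈p-x = x∈p∧x≢y⇒x∈p-y y∈p (x≢y ∘ sym)
    z∈p-x-y = x∈p∧x≢y⇒x∈p-y (x∈p∧x≢y⇒x∈p-y z∈p (x≢z ∘ sym)) (y≢z ∘ sym)

module _ {n : ℕ} {p : Subset n} (∣p∣≡2 : ∣ p ∣ ≡ 2) {x y : Fin n} (x≢y : x ≢ y)
         (x∈p : x ∈ p) (y∈p : y ∈ p) where

  ∈-pair : {z : Fin n} → z ∈ p → z ≡ x ⊎ z ≡ y
  ∈-pair {z} z∈p with z ≟ x | z ≟ y
  ... | yes z≡x | _       = inj₁ z≡x
  ... | no _    | yes z≡y = inj₂ z≡y
  ... | no z≢x  | no z≢y  =
    contradiction (subst (3 ≤_) ∣p∣≡2 (distinct₃⇒3≤∣p∣ x∈p y∈p z∈p x≢y (z≢x ∘ sym) (z≢y ∘ sym)))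
                  λ { (s≤s (s≤s ())) }

  ∈-pair₂ : {a b : Fin n} → a ∈ p → b ∈ p → a ≢ b → (a ≡ x × b ≡ y) ⊎ (a ≡ y × b ≡ x)
  ∈-pair₂ a∈p b∈p a≢b with ∈-pair a∈p | ∈-pair b∈p
  ... | inj₁ a≡x | inj₁ b≡x = contradiction (trans a≡x (sym b≡x)) a≢b
  ... | inj₁ a≡x | inj₂ b≡y = inj₁ (a≡x , b≡y)
  ... | inj₂ a≡y | inj₁ b≡x = inj₂ (a≡y , b≡x)
  ... | inj₂ a≡y | inj₂ b≡y = contradiction (trans a≡y (sym b≡y)) a≢b

  ∣p∣≡2⇒p⊆q : {q : Subset n} → x ∈ q → y ∈ q → p ⊆ q
  ∣p∣≡2⇒p⊆q x∈q y∈q z∈p with ∈-pair z∈p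
  ... | inj₁ refl = x∈q
  ... | inj₂ refl = y∈q

∣p∣≥2⇒distinct : ∀ {n} (p : Subset n) → 2 ≤ ∣ p ∣ → ∃₂ λ x y → x ≢ y × x ∈ p × y ∈ p
∣p∣≥2⇒distinct (inside ∷ p) (s≤s 1≤∣p∣) with ∣p∣>0⇒Nonempty 1≤∣p∣
... | y , y∈p = zero , suc y , (λ ()) , here , there y∈p
∣p∣≥2⇒distinct (outside ∷ p) 2≤∣p∣ with ∣p∣≥2⇒distinct p 2≤∣p∣
... | x , y , x≢y , x∈p , y∈p = suc x , suc y , x≢y ∘ suc-injective , there x∈p , there y∈p

module _ {m : ℕ} where

  PairCondition⇒≡∨suc : {i j : Fin m} → PairCondition i j → toℕ j ≡ toℕ i ⊎ toℕ j ≡ suc (toℕ i)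
  PairCondition⇒≡∨suc (inj₁ (i≡last , j≡last)) = inj₁ (trans j≡last (sym i≡last))
  PairCondition⇒≡∨suc (inj₂ (_ , j≡i∨1+i))     = j≡i∨1+i

  PairCondition-antisym : {i j : Fin m} → PairCondition i j → PairCondition j i → i ≡ j
  PairCondition-antisym pc-ij pc-ji with PairCondition⇒≡∨suc pc-ij | PairCondition⇒≡∨suc pc-ji
  ... | inj₁ j≡i   | _          = toℕ-injective (sym j≡i)
  ... | inj₂ _     | inj₁ i≡j   = toℕ-injective i≡j
  ... | inj₂ j≡1+i | inj₂ i≡1+j = contradiction (≤-reflexive (sym j≡1+i)) (<-asym (≤-reflexive (sym i≡1+j)))

  PairCondition-refl : (i : Fin m) → PairCondition i i
  PairCondition-refl i with m≤n⇒m<n∨m≡n (toℕ≤pred[n] i)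
  ... | inj₁ i<last = inj₂ (i<last , inj₁ refl)
  ... | inj₂ i≡last = inj₁ (i≡last , i≡last)

  PairCondition-inject₁ : (i : Fin m) → PairCondition (inject₁ i) (suc i)
  PairCondition-inject₁ i rewrite toℕ-inject₁ i = inj₂ (toℕ<n i , inj₂ refl)

PairCondition-predecessor : ∀ {m} (i : Fin m) → 0 < toℕ i →
  ∃ λ k → k ≢ i × PairCondition k i × toℕ i ≤ suc (toℕ k)
PairCondition-predecessor (suc i) _ =
  inject₁ i , inject₁≢suc , PairCondition-inject₁ i , ≤-reflexive (cong suc (sym (toℕ-inject₁ i)))
  where
  inject₁≢suc : inject₁ i ≢ suc i
  inject₁≢suc eq = 1+n≢n (sym (trans (sym (toℕ-inject₁ i)) (cong toℕ eq)))

PairCondition-neighbour : ∀ {m} {i j : Fin m} → PairCondition i j → 0 < toℕ i →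
  ∃ λ k → k ≢ i × PairCondition k j × toℕ i ≤ suc (toℕ k)
PairCondition-neighbour {i = i} {j} pc 0<i with PairCondition⇒≡∨suc pc
... | inj₂ j≡1+i = j , j≢i , PairCondition-refl j , <⇒≤ (m<n⇒m<1+n (≤-reflexive (sym j≡1+i)))
  where
  j≢i : j ≢ i
  j≢i j≡i = 1+n≢n (trans (sym j≡1+i) (cong toℕ j≡i))
... | inj₁ j≡i with toℕ-injective j≡i
... | refl = PairCondition-predecessor i 0<i

AlmostComplete : ∀ {n} → Graph n → Fin n → Fin n → Subset n → Set
AlmostComplete H u v S =
  ∀ a b → a ∈ S → b ∈ S → a ≢ b → ¬ (a ≡ u × b ≡ v) → ¬ (a ≡ v × b ≡ u) → H a b

AlmostComplete-mono : ∀ {n} {H H′ : Graph n} {u v S} → (∀ {a b} → H a b → H′ a b) →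
  AlmostComplete H u v S → AlmostComplete H′ u v S
AlmostComplete-mono H⊆H′ S-complete a b a∈S b∈S a≢b ≢uv ≢vu = H⊆H′ (S-complete a b a∈S b∈S a≢b ≢uv ≢vu)

AlmostComplete-⊆ : ∀ {n} {H : Graph n} {u v S T} → T ⊆ S → AlmostComplete H u v S → AlmostComplete H u v T
AlmostComplete-⊆ T⊆S S-complete a b a∈T b∈T = S-complete a b (T⊆S a∈T) (T⊆S b∈T)

module KrProcess {r n m : ℕ} (e : Hyp n m) (uniform : Uniform r e) (free : InducedKrMinusFree r e)
  (f : Fin m → Subset n) (∣f∣≡2 : ∀ i → ∣ f i ∣ ≡ 2) (f⊆e : ∀ i → f i ⊆ e i)
  (f⊆e⇔ : ∀ i j → (f i ⊆ e j) ⇔ PairCondition i j) where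

  G₀ : Graph n
  G₀ = RemovePairs (Skeleton e) f

  G : ℕ → Graph n
  G = Process r G₀

  Skeleton∖f≥ : ℕ → Graph n
  Skeleton∖f≥ t u v = Skeleton e u v × (∀ i → u ∈ f i → v ∈ f i → toℕ i < t)

  Invariant : ℕ → Set
  Invariant t = ∀ u v → G t u v ⇔ Skeleton∖f≥ t u v

  f-distinct : (i : Fin m) → ∃₂ λ u v → u ≢ v × u ∈ f i × v ∈ f i
  f-distinct i = ∣p∣≥2⇒distinct (f i) (≤-reflexive (sym (∣f∣≡2 i)))

  f-in-skeleton : ∀ {u v i} → u ≢ v → u ∈ f i → v ∈ f i → Skeleton e u v
  f-in-skeleton {i = i} u≢v u∈fi v∈fi = u≢v , i , f⊆e i u∈fi , f⊆e i v∈fi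

  pair∈e⇒PairCondition : ∀ {u v i j} → u ≢ v → u ∈ f i → v ∈ f i → u ∈ e j → v ∈ e j →
    PairCondition i j
  pair∈e⇒PairCondition {i = i} {j} u≢v u∈fi v∈fi u∈ej v∈ej =
    to (f⊆e⇔ i j) (∣p∣≡2⇒p⊆q (∣f∣≡2 i) u≢v u∈fi v∈fi u∈ej v∈ej)

  f-unique : ∀ {u v i k} → u ≢ v → u ∈ f i → v ∈ f i → u ∈ f k → v ∈ f k → i ≡ k
  f-unique {i = i} {k} u≢v u∈fi v∈fi u∈fk v∈fk = PairCondition-antisym
    (pair∈e⇒PairCondition u≢v u∈fi v∈fi (f⊆e k u∈fk) (f⊆e k v∈fk))
    (pair∈e⇒PairCondition u≢v u∈fk v∈fk (f⊆e i u∈fi) (f⊆e i v∈fi))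

  G⊆Skeleton : ∀ {t u v} → Invariant t → G t u v → Skeleton e u v
  G⊆Skeleton inv G-uv = proj₁ (to (inv _ _) G-uv)

  f-absent-before : ∀ {t u v} → Invariant t → (i : Fin m) → u ∈ f i → v ∈ f i →
    G t u v → toℕ i < t
  f-absent-before inv i u∈fi v∈fi G-uv = proj₂ (to (inv _ _) G-uv) i u∈fi v∈fi

  completion-in-edge : ∀ {t u v} → Invariant t → CompletesKr r (G t) u v →
    ∃ λ j → u ∈ e j × v ∈ e j × AlmostComplete (G t) u v (e j)
  completion-in-edge {u = u} {v} inv (u≢v , _ , S , ∣S∣≡r , u∈S , v∈S , S-complete)
    with free S (∣S∣≡r , u , v , u∈S , v∈S , u≢v , AlmostComplete-mono (G⊆Skeleton inv) S-complete)
  ... | j , S⊆ej = j , S⊆ej u∈S , S⊆ej v∈S ,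
    AlmostComplete-⊆ (⊆∧∣p∣≡∣q∣⇒⊇ S⊆ej (trans ∣S∣≡r (sym (uniform j)))) S-complete

  other-pair-present : ∀ {t u v i j k} → Invariant t → u ≢ v → u ∈ f i → v ∈ f i →
    AlmostComplete (G t) u v (e j) → f k ⊆ e j → k ≢ i → toℕ k < t
  other-pair-present {u = u} {v} {i} {j} {k} inv u≢v u∈fi v∈fi ej-complete fk⊆ej k≢i
    with f-distinct k
  ... | a , b , a≢b , a∈fk , b∈fk =
    f-absent-before inv k a∈fk b∈fk (ej-complete a b (fk⊆ej a∈fk) (fk⊆ej b∈fk) a≢b ≢uv ≢vu)
    where
    uv⊈fk : ¬ (u ∈ f k × v ∈ f k)
    uv⊈fk (u∈fk , v∈fk) = k≢i (f-unique u≢v u∈fk v∈fk u∈fi v∈fi)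
    ≢uv : ¬ (a ≡ u × b ≡ v)
    ≢uv (refl , refl) = uv⊈fk (a∈fk , b∈fk)
    ≢vu : ¬ (a ≡ v × b ≡ u)
    ≢vu (refl , refl) = uv⊈fk (b∈fk , a∈fk)

  completion-sound : ∀ {t u v} → Invariant t → CompletesKr r (G t) u v → Skeleton∖f≥ (suc t) u v
  completion-sound {t} {u} {v} inv c@(u≢v , _) with completion-in-edge inv c
  ... | j , u∈ej , v∈ej , ej-complete = (u≢v , j , u∈ej , v∈ej) , bound
    where
    bound : ∀ i → u ∈ f i → v ∈ f i → toℕ i < suc t
    bound i u∈fi v∈fi with toℕ i <? suc t
    ... | yes i<1+t = i<1+t
    ... | no i≮1+t
      with PairCondition-neighbour (pair∈e⇒PairCondition u≢v u∈fi v∈fi u∈ej v∈ej)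
                                   (<-≤-trans (s≤s z≤n) (≮⇒≥ i≮1+t))
    ... | k , k≢i , pc-kj , i≤1+k =
      contradiction (s≤s⁻¹ (≤-trans (≮⇒≥ i≮1+t) i≤1+k))
                    (<⇒≱ (other-pair-present inv u≢v u∈fi v∈fi ej-complete (from (f⊆e⇔ k j) pc-kj) k≢i))

  edge-almost-complete : ∀ {t u v} → Invariant t → (i : Fin m) → toℕ i ≡ t →
    u ≢ v → u ∈ f i → v ∈ f i → AlmostComplete (G t) u v (e i)
  edge-almost-complete inv i i≡t u≢v u∈fi v∈fi a b a∈ei b∈ei a≢b ≢uv ≢vu =
    from (inv a b) ((a≢b , i , a∈ei , b∈ei) , bound)
    where
    bound : ∀ k → a ∈ f k → b ∈ f k → toℕ k < _
    bound k a∈fk b∈fk with PairCondition⇒≡∨suc (pair∈e⇒PairCondition a≢b a∈fk b∈fk a∈ei b∈ei)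
    ... | inj₂ i≡1+k = ≤-reflexive (trans (sym i≡1+k) i≡t)
    ... | inj₁ i≡k with toℕ-injective i≡k
    ... | refl with ∈-pair₂ (∣f∣≡2 i) u≢v u∈fi v∈fi a∈fk b∈fk a≢b
    ... | inj₁ ≡uv = contradiction ≡uv ≢uv
    ... | inj₂ ≡vu = contradiction ≡vu ≢vu

  pair-completes : ∀ {t u v} → Invariant t → (i : Fin m) → toℕ i ≡ t →
    u ≢ v → u ∈ f i → v ∈ f i → CompletesKr r (G t) u v
  pair-completes inv i i≡t u≢v u∈fi v∈fi =
    u≢v , <-irrefl i≡t ∘ f-absent-before inv i u∈fi v∈fi ,
    e i , uniform i , f⊆e i u∈fi , f⊆e i v∈fi , edge-almost-complete inv i i≡t u≢v u∈fi v∈fi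

  step-sound : ∀ {t u v} → Invariant t → G (suc t) u v → Skeleton∖f≥ (suc t) u v
  step-sound inv (inj₁ G-uv) with to (inv _ _) G-uv
  ... | sk , bound = sk , λ i u∈fi v∈fi → m<n⇒m<1+n (bound i u∈fi v∈fi)
  step-sound inv (inj₂ c) = completion-sound inv c

  step-complete : ∀ {t u v} → Invariant t → Skeleton∖f≥ (suc t) u v → G (suc t) u v
  step-complete {t} {u} {v} inv (sk , bound) with t <? m
  ... | no t≮m = inj₁ (from (inv u v) (sk , λ i _ _ → <-≤-trans (toℕ<n i) (≮⇒≥ t≮m)))
  ... | yes t<m with (u ∈? f (fromℕ< t<m)) ×-dec (v ∈? f (fromℕ< t<m))
  ...   | yes (u∈ft , v∈ft) = inj₂ (pair-completes inv (fromℕ< t<m) (toℕ-fromℕ< t<m) (proj₁ sk) u∈ft v∈ft)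
  ...   | no uv⊈ft = inj₁ (from (inv u v) (sk , bound′))
    where
    bound′ : ∀ i → u ∈ f i → v ∈ f i → toℕ i < t
    bound′ i u∈fi v∈fi = ≤∧≢⇒< (s≤s⁻¹ (bound i u∈fi v∈fi)) λ i≡t →
      uv⊈ft (subst (λ k → u ∈ f k × v ∈ f k)
                   (toℕ-injective (trans i≡t (sym (toℕ-fromℕ< t<m)))) (u∈fi , v∈fi))

  invariant : ∀ t → Invariant t
  invariant zero u v = mk⇔
    (λ (sk , uv⊈f) → sk , λ i u∈fi v∈fi → contradiction (i , u∈fi , v∈fi) uv⊈f)
    (λ (sk , bound) → sk , λ (i , u∈fi , v∈fi) → contradiction (bound i u∈fi v∈fi) λ ())
  invariant (suc t) u v = mk⇔ (step-sound (invariant t)) (step-complete (invariant t))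

  f-added-at : (i : Fin m) → RunningTimeAtLeast r G₀ (suc (toℕ i))
  f-added-at i with f-distinct i
  ... | u , v , u≢v , u∈fi , v∈fi =
    u , v , from (invariant _ u v) (f-in-skeleton u≢v u∈fi v∈fi , bound) ,
    <-irrefl refl ∘ f-absent-before (invariant _) i u∈fi v∈fi
    where
    bound : ∀ k → u ∈ f k → v ∈ f k → toℕ k < suc (toℕ i)
    bound k u∈fk v∈fk = s≤s (≤-reflexive (cong toℕ (f-unique u≢v u∈fk v∈fk u∈fi v∈fi)))

  runningTime≥ : ∀ t → t ≤ m → RunningTimeAtLeast r G₀ t
  runningTime≥ zero    _   = tt
  runningTime≥ (suc t) t<m = subst (RunningTimeAtLeast r G₀ ∘ suc) (toℕ-fromℕ< t<m) (f-added-at (fromℕ< t<m))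

mainTheorem3 : (r n m : ℕ) → 2 ≤ r → (e : Hyp n m) → Injective _≡_ _≡_ e →
    Uniform r e → InducedKrMinusFree r e →
    (f : Fin m → Subset n) → (∀ i → ∣ f i ∣ ≡ 2) → (∀ i → f i ⊆ e i) →
    (∀ i j → (f i ⊆ e j) ⇔ PairCondition i j) →
    RunningTimeAtLeast r (RemovePairs (Skeleton e) f) m × MAtLeast r n m
mainTheorem3 r n m _ e _ uniform free f ∣f∣≡2 f⊆e f⊆e⇔ = runningTime , (G₀ , runningTime)
  where
  open KrProcess e uniform free f ∣f∣≡2 f⊆e f⊆e⇔
  runningTime : RunningTimeAtLeast r G₀ m
  runningTime = runningTime≥ m ≤-refl
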